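{- For every integer $v\ge 3$, $\xi_{3,4}(v)\equiv\frac{v(1-v)}{2}\pmod 3$; more specifically, $\xi_{3,4}(v)\equiv 2\pmod 3$ if $v\equiv 2\pmod 3$, and $\xi_{3,4}(v)\equiv 0\pmod 3$ otherwise.
   Context: A $2$-$(v,\{3,4\},1)$ covering is a collection (repetitions allowed) of $3$-subsets and $4$-subsets (blocks) of a $v$-set $X$ such that every $2$-subset of $X$ lies in at least one block. Its excess size is $\sum_B\binom{|B|}2-\binom v2$ (pairs covered more than once, counted with multiplicity). $\xi_{3,4}(v)$ denotes the minimum excess size over all $2$-$(v,\{3,4\},1)$ coverings. -}

module Defs where

open import Data.Nat using (ℕ; _∸_)
open import Data.Nat.Combinatorics using (_C_)
open import Data.Fin using (Fin)
open import Data.Fin.Subset using (Subset; _∈_; ∣_∣)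
open import Data.List using (List; map)
open import Data.Nat.ListAction using (sum)
open import Data.List.Relation.Unary.All using (All)
open import Data.List.Relation.Unary.Any using (Any)
open import Data.Product using (_×_)
open import Data.Sum using (_⊎_)
open import Relation.Binary.PropositionalEquality using (_≡_; _≢_)

-- The v-set X is Fin v; a block is a subset of Fin v; a collection of blocks
-- (repetitions allowed) is a list of subsets.

BlockSizes : (v : ℕ) → List (Subset v) → Set
BlockSizes v bs = All (λ B → ∣ B ∣ ≡ 3 ⊎ ∣ B ∣ ≡ 4) bs

CoversPairs : (v : ℕ) → List (Subset v) → Set
CoversPairs v bs = (x y : Fin v) → x ≢ y → Any (λ B → x ∈ B × y ∈ B) bs

IsCovering34 : (v : ℕ) → List (Subset v) → Set
IsCovering34 v bs = BlockSizes v bs × CoversPairs v bs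

-- excess size: sum over blocks of C(|B|,2), minus C(v,2)
-- (truncated subtraction is exact for coverings, since the sum is ≥ C(v,2))
excess : (v : ℕ) → List (Subset v) → ℕ
excess v bs = sum (map (λ B → ∣ B ∣ C 2) bs) ∸ (v C 2)

IsXi34 : (v : ℕ) → ℕ → Set
IsXi34 v m =
  (Data.Product.Σ (List (Subset v)) (λ bs → IsCovering34 v bs × excess v bs ≡ m))
  × ((bs : List (Subset v)) → IsCovering34 v bs → m Data.Nat.≤ excess v bs)

module Submission where

-- A covering by blocks of sizes 3 and 4 covers Σ_B C(|B|,2) pairs with
-- multiplicity, and each term C(3,2) = 3, C(4,2) = 6 is divisible by 3.
-- Since every pair is covered, this sum is at least C(v,2) (induct on v:
-- the pairs through one point are covered by its link, the rest by the
-- blocks with that point deleted), so ξ + C(v,2) equals it and is divisible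
-- by 3.  The residues follow from C(v,2) ≡ 1 or 0 (mod 3) according as
-- v ≡ 2 (mod 3) or not.

open import Defs
open import Data.Nat using (ℕ; zero; suc; _+_; _∸_; _*_; _≤_; _<_; _%_; z≤n; s≤s)
open import Data.Nat.Properties
open import Data.Nat.Combinatorics using (_C_; nCk+nC[k+1]≡[n+1]C[k+1]; nC1≡n)
open import Data.Nat.Divisibility using (_∣_; divides; ∣m∣n⇒∣m+n; n∣m⇒m%n≡0)
open import Data.Nat.DivMod using (%-distribˡ-+; m%n<n; [m+n]%n≡m%n; [m+kn]%n≡m%n)
open import Data.Nat.ListAction using (sum)
open import Data.Nat.Tactic.RingSolver using (solve-∀)
open import Data.Fin as Fin using (Fin)
import Data.Fin.Properties as Fin
open import Data.Fin.Subset using (Subset; inside; outside; ∣_∣; _∪_; ⊤; ⋃; _∈_)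
open import Data.Fin.Subset.Properties using (x∈p∪q⁺; ∣⊥∣≡0; ∣⊤∣≡n; p⊆q⇒∣p∣≤∣q∣)
open import Data.Vec using ([]; _∷_; here; there; tail)
open import Data.List using (List; []; _∷_; map)
open import Data.List.Relation.Unary.All as All using (All; []; _∷_)
open import Data.List.Relation.Unary.All.Properties using (map⁺)
open import Data.List.Relation.Unary.Any using (Any; here; there)
open import Data.Product using (_×_; _,_; proj₁; proj₂)
open import Data.Sum using (_⊎_; inj₁; inj₂)
open import Algebra.Properties.CommutativeSemigroup +-commutativeSemigroup using (interchange; x∙yz≈y∙xz)
open import Relation.Nullary using (contradiction)
open import Relation.Binary.PropositionalEquality using (_≡_; _≢_; refl; sym; trans; cong; cong₂; subst; module ≡-Reasoning)

C2-suc : ∀ n → suc n C 2 ≡ n + n C 2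
C2-suc n = trans (sym (nCk+nC[k+1]≡[n+1]C[k+1] n 1)) (cong (_+ n C 2) (nC1≡n n))

C2-+3 : ∀ n → (3 + n) C 2 ≡ n C 2 + suc n * 3
C2-+3 n rewrite C2-suc (suc (suc n)) | C2-suc (suc n) | C2-suc n = arith n (n C 2)
  where
  arith : ∀ a c → suc (suc (a + suc (a + (a + c)))) ≡ c + suc a * 3
  arith = solve-∀

C2-mod3 : ∀ n → (n % 3 ≡ 2 → (n C 2) % 3 ≡ 1) × (n % 3 ≢ 2 → (n C 2) % 3 ≡ 0)
C2-mod3 0 = (λ ()) , λ _ → refl
C2-mod3 1 = (λ ()) , λ _ → refl
C2-mod3 2 = (λ _ → refl) , λ n%3≢2 → contradiction refl n%3≢2
C2-mod3 (suc (suc (suc n))) with C2-mod3 n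
... | ≡2⇒≡1 , ≢2⇒≡0 =
  (λ e → trans C2-period (≡2⇒≡1 (trans (sym period) e))) ,
  (λ e → trans C2-period (≢2⇒≡0 (λ e′ → e (trans period e′))))
  where
  period : (3 + n) % 3 ≡ n % 3
  period = trans (cong (_% 3) (+-comm 3 n)) ([m+n]%n≡m%n n 3)
  C2-period : ((3 + n) C 2) % 3 ≡ (n C 2) % 3
  C2-period = trans (cong (_% 3) (C2-+3 n)) ([m+kn]%n≡m%n (n C 2) (suc n) 3)

∣p∪q∣≤∣p∣+∣q∣ : ∀ {n} (p q : Subset n) → ∣ p ∪ q ∣ ≤ ∣ p ∣ + ∣ q ∣
∣p∪q∣≤∣p∣+∣q∣ [] [] = z≤n
∣p∪q∣≤∣p∣+∣q∣ (outside ∷ p) (outside ∷ q) = ∣p∪q∣≤∣p∣+∣q∣ p q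
∣p∪q∣≤∣p∣+∣q∣ (outside ∷ p) (inside ∷ q) =
  subst (suc ∣ p ∪ q ∣ ≤_) (sym (+-suc ∣ p ∣ ∣ q ∣)) (s≤s (∣p∪q∣≤∣p∣+∣q∣ p q))
∣p∪q∣≤∣p∣+∣q∣ (inside ∷ p) (outside ∷ q) = s≤s (∣p∪q∣≤∣p∣+∣q∣ p q)
∣p∪q∣≤∣p∣+∣q∣ (inside ∷ p) (inside ∷ q) =
  s≤s (≤-trans (∣p∪q∣≤∣p∣+∣q∣ p q) (+-monoʳ-≤ ∣ p ∣ (n≤1+n ∣ q ∣)))

∣⋃ps∣≤sum : ∀ {n} (ps : List (Subset n)) → ∣ ⋃ ps ∣ ≤ sum (map ∣_∣ ps)
∣⋃ps∣≤sum {n} [] = ≤-reflexive (∣⊥∣≡0 n)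
∣⋃ps∣≤sum (p ∷ ps) = ≤-trans (∣p∪q∣≤∣p∣+∣q∣ p (⋃ ps)) (+-monoʳ-≤ ∣ p ∣ (∣⋃ps∣≤sum ps))

x∈⋃⁺ : ∀ {n} {x : Fin n} (ps : List (Subset n)) → Any (x ∈_) ps → x ∈ ⋃ ps
x∈⋃⁺ (p ∷ ps) (here x∈p) = x∈p∪q⁺ (inj₁ x∈p)
x∈⋃⁺ (p ∷ ps) (there x∈⋃) = x∈p∪q⁺ {p = p} (inj₂ (x∈⋃⁺ ps x∈⋃))

n≤sum-of-cover : ∀ {n} (ps : List (Subset n)) → (∀ x → Any (x ∈_) ps) → n ≤ sum (map ∣_∣ ps)
n≤sum-of-cover {n} ps cover = begin
  n               ≡⟨ ∣⊤∣≡n n ⟨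
  ∣ ⊤ {n} ∣       ≤⟨ p⊆q⇒∣p∣≤∣q∣ {p = ⊤} (λ {x} _ → x∈⋃⁺ ps (cover x)) ⟩
  ∣ ⋃ ps ∣        ≤⟨ ∣⋃ps∣≤sum ps ⟩
  sum (map ∣_∣ ps) ∎
  where open ≤-Reasoning

blockPairs : ∀ {v} → List (Subset v) → ℕ
blockPairs bs = sum (map (λ B → ∣ B ∣ C 2) bs)

-- The blocks through the point 0, with 0 removed: their sizes count, with
-- multiplicity, the pairs {0, y} covered by the collection.
link : ∀ {v} → List (Subset (suc v)) → List (Subset v)
link [] = []
link ((inside ∷ B) ∷ bs) = B ∷ link bs
link ((outside ∷ B) ∷ bs) = link bs

blockPairs-split : ∀ {v} (bs : List (Subset (suc v))) →
  blockPairs bs ≡ sum (map ∣_∣ (link bs)) + blockPairs (map tail bs)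
blockPairs-split [] = refl
blockPairs-split ((inside ∷ B) ∷ bs) = begin
  suc ∣ B ∣ C 2 + blockPairs bs
    ≡⟨ cong₂ _+_ (C2-suc ∣ B ∣) (blockPairs-split bs) ⟩
  (∣ B ∣ + ∣ B ∣ C 2) + (sum (map ∣_∣ (link bs)) + blockPairs (map tail bs))
    ≡⟨ interchange ∣ B ∣ (∣ B ∣ C 2) _ _ ⟩
  (∣ B ∣ + sum (map ∣_∣ (link bs))) + (∣ B ∣ C 2 + blockPairs (map tail bs))
    ∎
  where open ≡-Reasoning
blockPairs-split ((outside ∷ B) ∷ bs) =
  trans (cong (∣ B ∣ C 2 +_) (blockPairs-split bs))
        (x∙yz≈y∙xz (∣ B ∣ C 2) (sum (map ∣_∣ (link bs))) (blockPairs (map tail bs)))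

link-covers : ∀ {v} (bs : List (Subset (suc v))) → CoversPairs (suc v) bs →
  ∀ y → Any (y ∈_) (link bs)
link-covers bs cover y = through-zero bs (cover Fin.zero (Fin.suc y) λ ())
  where
  through-zero : ∀ bs → Any (λ B → Fin.zero ∈ B × Fin.suc y ∈ B) bs → Any (y ∈_) (link bs)
  through-zero ((inside ∷ B) ∷ bs) (here (_ , there y∈B)) = here y∈B
  through-zero ((inside ∷ B) ∷ bs) (there p) = there (through-zero bs p)
  through-zero ((outside ∷ B) ∷ bs) (there p) = through-zero bs p

tails-cover : ∀ {v} (bs : List (Subset (suc v))) → CoversPairs (suc v) bs →
  CoversPairs v (map tail bs)
tails-cover bs cover x y x≢y =
  drop-zero bs (cover (Fin.suc x) (Fin.suc y) (λ e → x≢y (Fin.suc-injective e)))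
  where
  drop-zero : ∀ bs → Any (λ B → Fin.suc x ∈ B × Fin.suc y ∈ B) bs →
    Any (λ B → x ∈ B × y ∈ B) (map tail bs)
  drop-zero ((_ ∷ B) ∷ bs) (here (there x∈B , there y∈B)) = here (x∈B , y∈B)
  drop-zero (B ∷ bs) (there p) = there (drop-zero bs p)

C2≤blockPairs : ∀ v (bs : List (Subset v)) → CoversPairs v bs → v C 2 ≤ blockPairs bs
C2≤blockPairs zero bs cover = z≤n
C2≤blockPairs (suc v) bs cover = begin
  suc v C 2
    ≡⟨ C2-suc v ⟩
  v + v C 2
    ≤⟨ +-mono-≤ (n≤sum-of-cover (link bs) (link-covers bs cover))
                (C2≤blockPairs v (map tail bs) (tails-cover bs cover)) ⟩
  sum (map ∣_∣ (link bs)) + blockPairs (map tail bs)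
    ≡⟨ blockPairs-split bs ⟨
  blockPairs bs
    ∎
  where open ≤-Reasoning

∣-sum : ∀ {d} {ns : List ℕ} → All (d ∣_) ns → d ∣ sum ns
∣-sum [] = divides 0 refl
∣-sum (d∣n ∷ d∣ns) = ∣m∣n⇒∣m+n d∣n (∣-sum d∣ns)

3∣blockPairs : ∀ {v} {bs : List (Subset v)} → BlockSizes v bs → 3 ∣ blockPairs bs
3∣blockPairs sizes = ∣-sum (map⁺ (All.map 3∣C2 sizes))
  where
  3∣C2 : ∀ {k} → k ≡ 3 ⊎ k ≡ 4 → 3 ∣ k C 2
  3∣C2 (inj₁ refl) = divides 1 refl
  3∣C2 (inj₂ refl) = divides 2 refl

3∣m+n⇒m%3≡[3∸n%3]%3 : ∀ m n → 3 ∣ m + n → m % 3 ≡ (3 ∸ n % 3) % 3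
3∣m+n⇒m%3≡[3∸n%3]%3 m n 3∣m+n = complement (m % 3) (n % 3) (m%n<n m 3) (m%n<n n 3)
  (trans (sym (%-distribˡ-+ m n 3)) (n∣m⇒m%n≡0 _ 3 3∣m+n))
  where
  complement : ∀ a b → a < 3 → b < 3 → (a + b) % 3 ≡ 0 → a ≡ (3 ∸ b) % 3
  complement 0 0 _ _ _ = refl
  complement 1 2 _ _ _ = refl
  complement 2 1 _ _ _ = refl
  complement 0 1 _ _ ()
  complement 0 2 _ _ ()
  complement 1 0 _ _ ()
  complement 1 1 _ _ ()
  complement 2 0 _ _ ()
  complement 2 2 _ _ ()
  complement (suc (suc (suc _))) _ (s≤s (s≤s (s≤s ()))) _ _
  complement _ (suc (suc (suc _))) _ (s≤s (s≤s (s≤s ()))) _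

lemma1 : (v m : ℕ) → 3 ≤ v → IsXi34 v m →
    (3 ∣ m + v C 2) × ((v % 3 ≡ 2 → m % 3 ≡ 2) × (v % 3 ≢ 2 → m % 3 ≡ 0))
lemma1 v m _ ((bs , (sizes , cover) , excess≡m) , _) =
  3∣m+C2 , (λ v≡2 → residue-of-m (proj₁ (C2-mod3 v) v≡2))
         , (λ v≢2 → residue-of-m (proj₂ (C2-mod3 v) v≢2))
  where
  m+C2≡blockPairs : m + v C 2 ≡ blockPairs bs
  m+C2≡blockPairs = subst (λ e → e + v C 2 ≡ blockPairs bs) excess≡m
                          (m∸n+n≡m (C2≤blockPairs v bs cover))
  3∣m+C2 : 3 ∣ m + v C 2
  3∣m+C2 = subst (3 ∣_) (sym m+C2≡blockPairs) (3∣blockPairs sizes)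
  residue-of-m : ∀ {r} → (v C 2) % 3 ≡ r → m % 3 ≡ (3 ∸ r) % 3
  residue-of-m refl = 3∣m+n⇒m%3≡[3∸n%3]%3 m (v C 2) 3∣m+C2
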